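{- Let $f(x)=g(a_2x^2+a_1x)+a_0\in\mathbb Z[x]$ with $g\ge1$ an integer and $\gcd(a_1,a_2)=1$. Then for every positive integer $l$, \[l!_{f(\mathbb Z)}=g^l\prod_{p\mid a_2}p^{k(p,l)}\prod_{p\nmid a_2}p^{k(p,2l)}\cdot 2^{ -\delta_{\{2\mid a_1,\ 2\nmid a_2\}}},\] where the products run over primes $p$, $k(p,l)=\sum_{k=1}^\infty\left\lfloor \frac{l}{p^k}\right\rfloor$, and $\delta_{\{2\mid a_1,\ 2\nmid a_2\}}$ equals $1$ if $a_1$ is even and $a_2$ is odd, and $0$ otherwise.
   Context: Bhargava factorial over $\mathbb Z$: let $S\subset\mathbb Z$ be infinite and $p$ a prime. A $p$-ordering of $S$ is a sequence $(a_n)_{n\ge0}$ in $S$ where $a_0\in S$ is arbitrary and, for $n\ge1$, $a_n\in S$ is chosen so that $v_p\bigl(\prod_{k=0}^{n-1}(a_n-a_k)\bigr)=\min_{x\in S}v_p\bigl(\prod_{k=0}^{n-1}(x-a_k)\bigr)$, with $v_p$ the $p$-adic valuation. Set $v_p(n;S)=v_p\bigl(\prod_{k=0}^{n-1}(a_n-a_k)\bigr)$; this is independent of the chosen $p$-ordering. The Bhargava factorial is the positive integer $l!_S=\prod_{p\text{ prime}}p^{v_p(l;S)}$. -}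

module Defs where

open import Data.Nat as ℕ using (ℕ; zero; suc; _+_; _*_; _^_; NonZero)
open import Data.Nat.Properties using (m^n≢0)
open import Data.Nat.DivMod using (_/_)
open import Data.Nat.Divisibility using (_∣_; _∣?_)
open import Data.Nat.Primality using (Prime; prime?; prime⇒nonZero)
open import Data.Integer as ℤ using (ℤ; ∣_∣)
open import Data.Bool using (Bool; true; false; if_then_else_; _∧_; not)
open import Data.Product using (Σ; ∃; _×_; _,_)
open import Relation.Nullary using (¬_; yes; no; does)
open import Function.Bundles using (_⇔_)
open import Relation.Binary.PropositionalEquality using (_≡_)

ℤSet : Set₁
ℤSet = ℤ → Set

prodDiff : (ℕ → ℤ) → ℕ → ℤ → ℤ
prodDiff a zero    x = ℤ.+ 1
prodDiff a (suc n) x = prodDiff a n x ℤ.* (x ℤ.- a n)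

-- The minimality of v_p is expressed with
-- divisibility by prime powers: v_p(P(a_n)) ≤ v_p(P(x)) iff every p^e
-- dividing P(a_n) also divides P(x) (with v_p(0) = ∞).  For n = 0 the
-- condition is vacuous, so a_0 ∈ S is arbitrary.
IsPOrdering : ℕ → ℤSet → (ℕ → ℤ) → Set
IsPOrdering p S a =
  ((n : ℕ) → S (a n)) ×
  ((n : ℕ) (x : ℤ) → S x → (e : ℕ) →
     p ^ e ∣ (∣ prodDiff a n (a n) ∣) → p ^ e ∣ (∣ prodDiff a n x ∣))

-- L = l!_S : L is positive and, for every prime p and every p-ordering a
-- of S, v_p(L) = v_p(∏_{k<l}(a_l - a_k)) = v_p(l;S)
-- (i.e. L = ∏_p p^{v_p(l;S)}).
IsBhargavaFactorial : ℤSet → ℕ → ℕ → Set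
IsBhargavaFactorial S l L =
  NonZero L ×
  ((p : ℕ) → Prime p → (a : ℕ → ℤ) → IsPOrdering p S a →
     (e : ℕ) → ((p ^ e ∣ L) ⇔ (p ^ e ∣ (∣ prodDiff a l (a l) ∣))))

image : (ℤ → ℤ) → ℤSet
image f y = ∃ λ (x : ℤ) → y ≡ f x

sum1 : (ℕ → ℕ) → ℕ → ℕ
sum1 f zero    = 0
sum1 f (suc n) = sum1 f n + f (suc n)

prodBelow : (ℕ → ℕ) → ℕ → ℕ
prodBelow f zero    = 1
prodBelow f (suc n) = prodBelow f n * f n

-- Legendre's k(p,l) = Σ_{k≥1} ⌊l/p^k⌋.  For p ≥ 2 the terms with k > l
-- vanish (p^k > l), so the sum is truncated at k = l.
legendre : (p l : ℕ) → .{{NonZero p}} → ℕ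
legendre p l = sum1 (λ k → _/_ l (p ^ k) {{m^n≢0 p k}}) l

primeFactor : ℤ → ℕ → ℕ → ℕ
primeFactor a₂ l p with prime? p
... | no  _  = 1
... | yes pr = p ^ (if does (p ∣? (∣ a₂ ∣))
                     then legendre p l {{prime⇒nonZero pr}}
                     else legendre p (2 * l) {{prime⇒nonZero pr}})

-- ∏_{p∣a₂} p^{k(p,l)} ∏_{p∤a₂} p^{k(p,2l)} over all primes p; primes
-- p > 2l contribute p^0 = 1, so the product is taken over p ≤ 2l.
primeProduct : ℤ → ℕ → ℕ
primeProduct a₂ l = prodBelow (primeFactor a₂ l) (suc (2 * l))

delta : ℤ → ℤ → ℕ
delta a₁ a₂ = if does (2 ∣? (∣ a₁ ∣)) ∧ not (does (2 ∣? (∣ a₂ ∣))) then 1 else 0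

quadPoly : ℕ → ℤ → ℤ → ℤ → ℤ → ℤ
quadPoly g a₂ a₁ a₀ x = ℤ.+ g ℤ.* (a₂ ℤ.* x ℤ.* x ℤ.+ a₁ ℤ.* x) ℤ.+ a₀

-- For a prime p and a p-ordering a of S = f(ℤ), the valuation of ∏_{k<l} (a_l − a_k) is compared with
-- that of a model set m(ℤ) whose p-orderings are explicit.  If p ∣ a₂ (so p ∤ a₁), then
-- f(y) − f(c) = g (y − c)(a₂(y + c) + a₁) with a p-adic unit as last factor, and the model is ℤ with
-- the ordering 0, 1, 2, … of valuation v_p(l!).  If p ∤ a₂, then a₂ (f(y) − f(c)) = g (m(W y) − m(W c))
-- for W y = a₂ y + h, where m(w) = w(w + 1) if a₁ = 2h + 1 and m(w) = w² if a₁ = 2h; as a₂ is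
-- invertible modulo every power of p, W is onto modulo p^e, and the orderings k(k + 1) and k² of the
-- models have valuations v_p((2l)!) and v_p((2l)!/2).  In every case the valuation for f(ℤ) is v_p(g^l)
-- plus that of the model, which is the p-part of g^l ∏_{p∣a₂} p^{k(p,l)} ∏_{p∤a₂} p^{k(p,2l)} / 2^δ.
-- Both inequalities use one half of Bhargava's theory: if all values on S of a monic polynomial of
-- degree l are divisible by p^e, then so is ∏_{k<l} (a_l − a_k), as one sees by expanding the
-- polynomial in the Newton basis ∏_{k<i} (x − a_k).
module Submission where

open import Defs

module Valuation where

  open import Data.Nat
    using (ℕ; zero; suc; _+_; _*_; _^_; _≤_; _<_; z≤n; s≤s; NonZero; >-nonZero; >-nonZero⁻¹; nonTrivial⇒n>1)
  open import Data.Nat.Properties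
  open import Data.Nat.Divisibility
  open import Data.Nat.Induction using (<-rec)
  open import Data.Nat.Primality using (Prime; euclidsLemma; prime⇒nonZero; prime⇒nonTrivial)
  open import Algebra.Properties.CommutativeSemigroup *-commutativeSemigroup
    using (x∙yz≈y∙xz; interchange)
  open import Data.Product using (∃; _×_; _,_)
  open import Data.Sum using (inj₁; inj₂; [_,_]′)
  open import Data.Empty using (⊥-elim)
  open import Function.Bundles using (_⇔_; mk⇔)
  open import Relation.Binary.Definitions using (tri<; tri≈; tri>)
  open import Relation.Nullary using (¬_; yes; no)
  open import Relation.Binary.PropositionalEquality

  record HasValuation (p X t : ℕ) : Set where
    constructor hasValuation
    field
      p^t∣X     : p ^ t ∣ X
      p^[1+t]∤X : ¬ p ^ suc t ∣ X

  open HasValuation public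

  -- v_p(A) ≤ v_p(B), with v_p(0) = ∞
  infix 4 _≼[_]_
  _≼[_]_ : ℕ → ℕ → ℕ → Set
  A ≼[ p ] B = ∀ e → p ^ e ∣ A → p ^ e ∣ B

  ^-monoʳ-∣ : ∀ p {m n} → m ≤ n → p ^ m ∣ p ^ n
  ^-monoʳ-∣ p z≤n       = 1∣ _
  ^-monoʳ-∣ p (s≤s m≤n) = *-monoʳ-∣ p (^-monoʳ-∣ p m≤n)

  module _ {p : ℕ} (pr : Prime p) where
    private instance
      p≢0 : NonZero p
      p≢0 = prime⇒nonZero pr

    prime>1 : 1 < p
    prime>1 = nonTrivial⇒n>1 p {{prime⇒nonTrivial pr}}

    prime∤1 : ¬ p ∣ 1
    prime∤1 p∣1 = <-irrefl (sym (∣1⇒≡1 p∣1)) prime>1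

    n<p^n : ∀ n → n < p ^ n
    n<p^n zero    = s≤s z≤n
    n<p^n (suc n) = ≤-trans (s≤s (n<p^n n)) (^-monoʳ-< p prime>1 (n<1+n n))

    ^-coprime-divisor : ∀ {m} → ¬ p ∣ m → ∀ e {n} → p ^ e ∣ m * n → p ^ e ∣ n
    ^-coprime-divisor p∤m zero    _ = 1∣ _
    ^-coprime-divisor {m} p∤m (suc e) {n} p^[1+e]∣mn
      with euclidsLemma m n pr (∣-trans (m∣m*n (p ^ e)) p^[1+e]∣mn)
    ... | inj₁ p∣m = ⊥-elim (p∤m p∣m)
    ... | inj₂ (divides q refl) =
      subst (_∣ q * p) (*-comm (p ^ e) p) (*-monoˡ-∣ p (^-coprime-divisor p∤m e p^e∣mq))
      where
      p^e∣mq : p ^ e ∣ m * q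
      p^e∣mq = *-cancelʳ-∣ p (subst (p ^ e * p ∣_) (sym (*-assoc m q p))
                 (subst (_∣ m * (q * p)) (*-comm p (p ^ e)) p^[1+e]∣mn))

    ∤⇒hasValuation : ∀ {x} t → ¬ p ∣ x → HasValuation p (x * p ^ t) t
    ∤⇒hasValuation {x} t p∤x = hasValuation (n∣m*n x)
      λ p*p^t∣x*p^t → p∤x (*-cancelʳ-∣ (p ^ t) {{m^n≢0 p t}} p*p^t∣x*p^t)

    hasValuation⇒∤ : ∀ {X t} → HasValuation p X t → ∃ λ x → ¬ p ∣ x × X ≡ x * p ^ t
    hasValuation⇒∤ (hasValuation (divides x refl) p^[1+t]∤X) =
      x , (λ p∣x → p^[1+t]∤X (*-monoˡ-∣ _ p∣x)) , refl

    valuation-unique : ∀ {X s t} → HasValuation p X s → HasValuation p X t → s ≡ t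
    valuation-unique {s = s} {t} (hasValuation p^s∣X p^[1+s]∤X) (hasValuation p^t∣X p^[1+t]∤X)
      with <-cmp s t
    ... | tri< s<t _ _ = ⊥-elim (p^[1+s]∤X (∣-trans (^-monoʳ-∣ p s<t) p^t∣X))
    ... | tri≈ _ s≡t _ = s≡t
    ... | tri> _ _ t<s = ⊥-elim (p^[1+t]∤X (∣-trans (^-monoʳ-∣ p t<s) p^s∣X))

    valuation-∣⇒≤ : ∀ {X t e} → HasValuation p X t → p ^ e ∣ X → e ≤ t
    valuation-∣⇒≤ {t = t} {e} (hasValuation _ p^[1+t]∤X) p^e∣X with ≤-<-connex e t
    ... | inj₁ e≤t = e≤t
    ... | inj₂ t<e = ⊥-elim (p^[1+t]∤X (∣-trans (^-monoʳ-∣ p t<e) p^e∣X))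

    valuation-≤⇒∣ : ∀ {X t e} → HasValuation p X t → e ≤ t → p ^ e ∣ X
    valuation-≤⇒∣ (hasValuation p^t∣X _) e≤t = ∣-trans (^-monoʳ-∣ p e≤t) p^t∣X

    valuation-⇔ : ∀ {X Y t} → HasValuation p X t → HasValuation p Y t →
                  ∀ e → (p ^ e ∣ X ⇔ p ^ e ∣ Y)
    valuation-⇔ hX hY e = mk⇔ (λ p^e∣X → valuation-≤⇒∣ hY (valuation-∣⇒≤ {e = e} hX p^e∣X))
                              (λ p^e∣Y → valuation-≤⇒∣ hX (valuation-∣⇒≤ {e = e} hY p^e∣Y))

    valuation-∤ : ∀ {m} → ¬ p ∣ m → HasValuation p m 0
    valuation-∤ {m} p∤m = subst (λ n → HasValuation p n 0) (*-identityʳ m) (∤⇒hasValuation 0 p∤m)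

    valuation-^ : ∀ e → HasValuation p (p ^ e) e
    valuation-^ e = subst (λ n → HasValuation p n e) (*-identityˡ (p ^ e)) (∤⇒hasValuation e prime∤1)

    valuation-* : ∀ {X Y s t} → HasValuation p X s → HasValuation p Y t → HasValuation p (X * Y) (s + t)
    valuation-* {s = s} {t} hX hY with hasValuation⇒∤ hX | hasValuation⇒∤ hY
    ... | x , p∤x , refl | y , p∤y , refl =
      subst (λ Z → HasValuation p Z (s + t)) regroup (∤⇒hasValuation (s + t) p∤xy)
      where
      p∤xy : ¬ p ∣ x * y
      p∤xy p∣xy = [ p∤x , p∤y ]′ (euclidsLemma x y pr p∣xy)
      regroup : x * y * p ^ (s + t) ≡ x * p ^ s * (y * p ^ t)
      regroup = trans (cong (x * y *_) (^-distribˡ-+-* p s t)) (interchange x y (p ^ s) (p ^ t))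

    valuation-exists : ∀ X → 0 < X → ∃ (HasValuation p X)
    valuation-exists = <-rec _ step
      where
      p¹ : HasValuation p p 1
      p¹ = subst (λ n → HasValuation p n 1) (*-identityʳ p) (valuation-^ 1)
      step : ∀ X → (∀ {Y} → Y < X → 0 < Y → ∃ (HasValuation p Y)) → 0 < X → ∃ (HasValuation p X)
      step X rec X>0 with p ∣? X
      ... | no p∤X = 0 , valuation-∤ p∤X
      ... | yes (divides q refl) =
        let q>0 = n≢0⇒n>0 λ { refl → <-irrefl refl X>0 }
            t , hq = rec (m<m*n q p {{>-nonZero q>0}} prime>1) q>0
        in suc t , subst (HasValuation p (q * p)) (+-comm t 1) (valuation-* hq p¹)

    valuation⇒>0 : ∀ {X t} → HasValuation p X t → 0 < X
    valuation⇒>0 {zero}  (hasValuation _ p^[1+t]∤0) = ⊥-elim (p^[1+t]∤0 (_ ∣0))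
    valuation⇒>0 {suc X} _                          = s≤s z≤n

    valuation-∣-cancelˡ : ∀ {X α} → HasValuation p X α → ∀ s {Y} → p ^ (α + s) ∣ X * Y → p ^ s ∣ Y
    valuation-∣-cancelˡ {X} {α} hX s {Y} p^[α+s]∣XY with hasValuation⇒∤ hX
    ... | x , p∤x , refl =
      ^-coprime-divisor p∤x s (*-cancelˡ-∣ (p ^ α) {{m^n≢0 p α}} p^α*p^s∣p^α*xY)
      where
      p^α*p^s∣p^α*xY : p ^ α * p ^ s ∣ p ^ α * (x * Y)
      p^α*p^s∣p^α*xY = subst₂ _∣_ (^-distribˡ-+-* p α s)
                         (trans (*-assoc x (p ^ α) Y) (x∙yz≈y∙xz x (p ^ α) Y)) p^[α+s]∣XY

    valuation-*-cancelˡ : ∀ {A B d t} → HasValuation p A d → HasValuation p (A * B) (d + t) →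
                          HasValuation p B t
    valuation-*-cancelˡ {A} {B} {d} {t} hA hAB with valuation-exists B B>0
      where
      B>0 : 0 < B
      B>0 = >-nonZero⁻¹ B {{m*n≢0⇒n≢0 A {{>-nonZero (valuation⇒>0 hAB)}}}}
    ... | t′ , hB = subst (HasValuation p B) (+-cancelˡ-≡ d t′ t (valuation-unique (valuation-* hA hB) hAB)) hB

    valuation-prodBelow-0 : ∀ {f} n → (∀ k → k < n → HasValuation p (f k) 0) →
                            HasValuation p (prodBelow f n) 0
    valuation-prodBelow-0 zero    _     = valuation-∤ prime∤1
    valuation-prodBelow-0 (suc n) f-val =
      valuation-* (valuation-prodBelow-0 n λ k k<n → f-val k (m<n⇒m<1+n k<n)) (f-val n ≤-refl)

    valuation-prodBelow-single : ∀ {f E} → (∀ q → q ≢ p → HasValuation p (f q) 0) →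
                                 HasValuation p (f p) E → ∀ n → p < n → HasValuation p (prodBelow f n) E
    valuation-prodBelow-single {f} {E} f-val fp-val (suc n) (s≤s p≤n) with m≤n⇒m<n∨m≡n p≤n
    ... | inj₁ p<n = subst (HasValuation p _) (+-identityʳ E)
      (valuation-* (valuation-prodBelow-single f-val fp-val n p<n) (f-val n (≢-sym (<⇒≢ p<n))))
    ... | inj₂ refl = valuation-* (valuation-prodBelow-0 n λ k k<n → f-val k (<⇒≢ k<n)) fp-val

    ∀p^e∣⇒≡0 : ∀ {B} → (∀ e → p ^ e ∣ B) → B ≡ 0
    ∀p^e∣⇒≡0 {zero}  _         = refl
    ∀p^e∣⇒≡0 {suc B} p^e∣1+B = ⊥-elim (<⇒≱ (n<p^n (suc B)) (∣⇒≤ (p^e∣1+B (suc B))))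

    *-monoʳ-≼ : ∀ {A B} c → A ≼[ p ] B → c * A ≼[ p ] c * B
    *-monoʳ-≼ {zero} {B} c A≼B e _ rewrite ∀p^e∣⇒≡0 (λ e → A≼B e ((p ^ e) ∣0)) =
      subst (p ^ e ∣_) (sym (*-zeroʳ c)) ((p ^ e) ∣0)
    *-monoʳ-≼ {A@(suc _)} c A≼B e p^e∣cA with valuation-exists A (s≤s z≤n)
    ... | t , hA with hasValuation⇒∤ hA
    ... | a , p∤a , A≡a*p^t = ∣-trans p^e∣c*p^t (*-monoʳ-∣ c (A≼B t (p^t∣X hA)))
      where
      p^e∣c*p^t : p ^ e ∣ c * p ^ t
      p^e∣c*p^t = ^-coprime-divisor p∤a e
        (subst (p ^ e ∣_) (trans (cong (c *_) A≡a*p^t) (x∙yz≈y∙xz c a (p ^ t))) p^e∣cA)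


module Legendre where

  open import Data.Nat using (ℕ; zero; suc; _+_; _*_; _^_; _⊓_; _≤_; _<_; z≤n; s≤s; NonZero; _!)
  open import Data.Nat.Properties
  open import Data.Nat.DivMod
    using (_/_; _%_; m≡m%n+[m/n]*n; m%n<n; m*n/n≡m; m<n⇒m/n≡0; +-distrib-/-∣ʳ)
  open import Data.Nat.Divisibility using (_∣_; divides; _∣?_; n∣m*n; ∣⇒≤)
  open import Data.Nat.Primality using (Prime; prime⇒nonZero)
  open import Data.Product using (_,_)
  open import Data.Sum using (inj₁; inj₂)
  open import Data.Empty using (⊥-elim)
  open import Relation.Nullary using (¬_; yes; no)
  open import Relation.Binary.PropositionalEquality
    using (_≡_; refl; sym; trans; cong; cong₂; subst; module ≡-Reasoning)
  open ≡-Reasoning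
  open import Algebra.Properties.CommutativeSemigroup +-commutativeSemigroup using (interchange)
  open Valuation

  [_∣_] : ℕ → ℕ → ℕ
  [ d ∣ m ] with d ∣? m
  ... | yes _ = 1
  ... | no  _ = 0

  ∣⇒[∣]≡1 : ∀ {d m} → d ∣ m → [ d ∣ m ] ≡ 1
  ∣⇒[∣]≡1 {d} {m} d∣m with d ∣? m
  ... | yes _   = refl
  ... | no  d∤m = ⊥-elim (d∤m d∣m)

  ∤⇒[∣]≡0 : ∀ {d m} → ¬ d ∣ m → [ d ∣ m ] ≡ 0
  ∤⇒[∣]≡0 {d} {m} d∤m with d ∣? m
  ... | yes d∣m = ⊥-elim (d∤m d∣m)
  ... | no  _   = refl

  [r+q*d]/d≡q : ∀ {r} q d .{{_ : NonZero d}} → r < d → (r + q * d) / d ≡ q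
  [r+q*d]/d≡q {r} q d r<d =
    trans (+-distrib-/-∣ʳ r (n∣m*n q)) (cong₂ _+_ (m<n⇒m/n≡0 r<d) (m*n/n≡m q d))

  suc-/ : ∀ n d .{{_ : NonZero d}} → suc n / d ≡ n / d + [ d ∣ suc n ]
  suc-/ n d with d ∣? suc n
  suc-/ n d@(suc d′) | yes (divides (suc k) 1+n≡[1+k]d) = begin
    suc n / d              ≡⟨ cong (_/ d) 1+n≡[1+k]d ⟩
    suc k * d / d          ≡⟨ m*n/n≡m (suc k) d ⟩
    suc k                  ≡⟨ +-comm 1 k ⟩
    k + 1                  ≡⟨ cong (_+ 1) ([r+q*d]/d≡q k d ≤-refl) ⟨
    (d′ + k * d) / d + 1   ≡⟨ cong (λ m → m / d + 1) (suc-injective 1+n≡[1+k]d) ⟨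
    n / d + 1              ∎
  suc-/ n (suc d′) | yes (divides zero ())
  suc-/ n d | no d∤1+n with m≤n⇒m<n∨m≡n (m%n<n n d)
  ... | inj₁ 1+r<d = begin
    suc n / d                      ≡⟨ cong (λ m → suc m / d) (m≡m%n+[m/n]*n n d) ⟩
    (suc (n % d) + n / d * d) / d  ≡⟨ [r+q*d]/d≡q (n / d) d 1+r<d ⟩
    n / d                          ≡⟨ +-identityʳ (n / d) ⟨
    n / d + 0                      ∎
  ... | inj₂ 1+r≡d = ⊥-elim (d∤1+n (divides (suc (n / d))
          (trans (cong suc (m≡m%n+[m/n]*n n d)) (cong (_+ n / d * d) 1+r≡d))))

  sum1-cong : ∀ {f g} n → (∀ k → f k ≡ g k) → sum1 f n ≡ sum1 g n
  sum1-cong zero    f≗g = refl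
  sum1-cong (suc n) f≗g = cong₂ _+_ (sum1-cong n f≗g) (f≗g (suc n))

  sum1-distrib-+ : ∀ f g n → sum1 (λ k → f k + g k) n ≡ sum1 f n + sum1 g n
  sum1-distrib-+ f g zero    = refl
  sum1-distrib-+ f g (suc n) =
    trans (cong (_+ (f (suc n) + g (suc n))) (sum1-distrib-+ f g n))
          (interchange (sum1 f n) (sum1 g n) (f (suc n)) (g (suc n)))

  sum1-zero : ∀ f n → (∀ k → f (suc k) ≡ 0) → sum1 f n ≡ 0
  sum1-zero f zero    _    = refl
  sum1-zero f (suc n) f≡0 = cong₂ _+_ (sum1-zero f n f≡0) (f≡0 n)

  legendre-< : ∀ p m .{{_ : NonZero p}} → m < p → legendre p m ≡ 0
  legendre-< p m m<p = sum1-zero _ m λ k →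
    m<n⇒m/n≡0 {{m^n≢0 p (suc k)}} (<-≤-trans m<p (m≤m*n p (p ^ k) {{m^n≢0 p k}}))

  module _ {p : ℕ} (pr : Prime p) where
    private instance
      p≢0 : NonZero p
      p≢0 = prime⇒nonZero pr

    infixl 7 _/p^_
    _/p^_ : ℕ → ℕ → ℕ
    n /p^ k = (n / p ^ k) {{m^n≢0 p k}}

    sum1-[p^k∣] : ∀ {m v} → HasValuation p m v → ∀ N → sum1 (λ k → [ p ^ k ∣ m ]) N ≡ N ⊓ v
    sum1-[p^k∣] m-val zero = refl
    sum1-[p^k∣] {m} {v} m-val (suc N) with ≤-<-connex (suc N) v
    ... | inj₁ 1+N≤v = begin
      sum1 (λ k → [ p ^ k ∣ m ]) N + [ p ^ suc N ∣ m ]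
        ≡⟨ cong₂ _+_ (sum1-[p^k∣] m-val N) (∣⇒[∣]≡1 (valuation-≤⇒∣ pr m-val 1+N≤v)) ⟩
      N ⊓ v + 1   ≡⟨ cong (_+ 1) (m≤n⇒m⊓n≡m (<⇒≤ 1+N≤v)) ⟩
      N + 1       ≡⟨ +-comm N 1 ⟩
      suc N       ≡⟨ m≤n⇒m⊓n≡m 1+N≤v ⟨
      suc N ⊓ v   ∎
    ... | inj₂ v<1+N = begin
      sum1 (λ k → [ p ^ k ∣ m ]) N + [ p ^ suc N ∣ m ]
        ≡⟨ cong₂ _+_ (sum1-[p^k∣] m-val N) (∤⇒[∣]≡0 p^[1+N]∤m) ⟩
      N ⊓ v + 0   ≡⟨ +-identityʳ (N ⊓ v) ⟩
      N ⊓ v       ≡⟨ m≥n⇒m⊓n≡n (≤-pred v<1+N) ⟩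
      v           ≡⟨ m≥n⇒m⊓n≡n (<⇒≤ v<1+N) ⟨
      suc N ⊓ v   ∎
      where
      p^[1+N]∤m : ¬ p ^ suc N ∣ m
      p^[1+N]∤m p^[1+N]∣m = <⇒≱ v<1+N (valuation-∣⇒≤ pr m-val p^[1+N]∣m)

    legendre-suc : ∀ {n v} → HasValuation p (suc n) v → legendre p (suc n) ≡ legendre p n + v
    legendre-suc {n} {v} 1+n-val = begin
      sum1 (λ k → suc n /p^ k) n + suc n /p^ suc n
        ≡⟨ cong₂ _+_ (sum1-cong n (λ k → suc-/ n (p ^ k) {{m^n≢0 p k}}))
                     (m<n⇒m/n≡0 {{m^n≢0 p (suc n)}} (n<p^n pr (suc n))) ⟩
      sum1 (λ k → n /p^ k + [ p ^ k ∣ suc n ]) n + 0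
        ≡⟨ +-identityʳ _ ⟩
      sum1 (λ k → n /p^ k + [ p ^ k ∣ suc n ]) n
        ≡⟨ sum1-distrib-+ (λ k → n /p^ k) (λ k → [ p ^ k ∣ suc n ]) n ⟩
      legendre p n + sum1 (λ k → [ p ^ k ∣ suc n ]) n
        ≡⟨ cong (legendre p n +_) (trans (sum1-[p^k∣] 1+n-val n) (m≥n⇒m⊓n≡n v≤n)) ⟩
      legendre p n + v
        ∎
      where
      v≤n : v ≤ n
      v≤n = ≤-pred (<-≤-trans (n<p^n pr v) (∣⇒≤ (p^t∣X 1+n-val)))

    valuation-! : ∀ n → HasValuation p (n !) (legendre p n)
    valuation-! zero    = valuation-∤ pr (prime∤1 pr)
    valuation-! (suc n) with valuation-exists pr (suc n) (s≤s z≤n)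
    ... | v , 1+n-val = subst (HasValuation p (suc n !)) (trans (+-comm v _) (sym (legendre-suc 1+n-val)))
                          (valuation-* pr 1+n-val (valuation-! n))


module PrimeProduct where

  open import Data.Nat using (ℕ; zero; suc; _*_; _^_; _<_; _<?_; NonZero)
  open import Data.Nat.Properties
  open import Data.Nat.Divisibility using (_∣_; _∣?_; ∣-refl)
  open import Data.Nat.Primality
    using (Prime; prime?; prime[2]; euclidsLemma; prime⇒irreducible; prime⇒nonZero)
  open import Data.Integer using (ℤ; ∣_∣)
  open import Data.Bool using (true; false; if_then_else_)
  open import Data.Sum using (inj₁; inj₂)
  open import Data.Empty using (⊥-elim)
  open import Relation.Nullary using (¬_; yes; no; does)
  open import Relation.Nullary.Decidable using (dec-true; dec-false)
  open import Relation.Binary.PropositionalEquality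
  open Valuation
  open Legendre using (legendre-<)

  prime∣prime^⇒≡ : ∀ {p q} → Prime p → Prime q → ∀ e → p ∣ q ^ e → p ≡ q
  prime∣prime^⇒≡ pp pq zero    p∣1   = ⊥-elim (prime∤1 pp p∣1)
  prime∣prime^⇒≡ {q = q} pp pq (suc e) p∣q^[1+e] with euclidsLemma q (q ^ e) pp p∣q^[1+e]
  ... | inj₂ p∣q^e = prime∣prime^⇒≡ pp pq e p∣q^e
  ... | inj₁ p∣q with prime⇒irreducible pq p∣q
  ...   | inj₁ refl = ⊥-elim (prime∤1 pp ∣-refl)
  ...   | inj₂ p≡q  = p≡q

  valuation-2^-≢ : ∀ {p} → Prime p → p ≢ 2 → ∀ k → HasValuation p (2 ^ k) 0
  valuation-2^-≢ pr p≢2 k = valuation-∤ pr λ p∣2^k → p≢2 (prime∣prime^⇒≡ pr prime[2] k p∣2^k)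

  primeExponent : ℤ → ℕ → (p : ℕ) → .{{NonZero p}} → ℕ
  primeExponent a₂ l p = if does (p ∣? ∣ a₂ ∣) then legendre p l else legendre p (2 * l)

  module _ (a₂ : ℤ) (l : ℕ) {p : ℕ} (pr : Prime p) where
    private instance
      p≢0 : NonZero p
      p≢0 = prime⇒nonZero pr

    primeExponent-∣ : p ∣ ∣ a₂ ∣ → primeExponent a₂ l p ≡ legendre p l
    primeExponent-∣ p∣a₂ =
      cong (if_then legendre p l else legendre p (2 * l)) (dec-true (p ∣? ∣ a₂ ∣) p∣a₂)

    primeExponent-∤ : ¬ p ∣ ∣ a₂ ∣ → primeExponent a₂ l p ≡ legendre p (2 * l)
    primeExponent-∤ p∤a₂ =
      cong (if_then legendre p l else legendre p (2 * l)) (dec-false (p ∣? ∣ a₂ ∣) p∤a₂)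

    valuation-primeFactor-≡ : HasValuation p (primeFactor a₂ l p) (primeExponent a₂ l p)
    valuation-primeFactor-≡ with prime? p
    ... | yes _  = valuation-^ pr (primeExponent a₂ l p)
    ... | no  ¬p = ⊥-elim (¬p pr)

    valuation-primeFactor-≢ : ∀ q → q ≢ p → HasValuation p (primeFactor a₂ l q) 0
    valuation-primeFactor-≢ q q≢p with prime? q
    ... | yes pq = valuation-∤ pr λ p∣q^e →
      q≢p (sym (prime∣prime^⇒≡ pr pq (primeExponent a₂ l q {{prime⇒nonZero pq}}) p∣q^e))
    ... | no  _  = valuation-∤ pr (prime∤1 pr)

    valuation-primeProduct : HasValuation p (primeProduct a₂ l) (primeExponent a₂ l p)
    valuation-primeProduct with p <? suc (2 * l)
    ... | yes p≤2l =
      valuation-prodBelow-single pr valuation-primeFactor-≢ valuation-primeFactor-≡ _ p≤2l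
    ... | no  p≰2l = subst (HasValuation p _) (sym exponent≡0) (valuation-prodBelow-0 pr _
          λ q q≤2l → valuation-primeFactor-≢ q (<⇒≢ (≤-<-trans (≤-pred q≤2l) 2l<p)))
      where
      2l<p : 2 * l < p
      2l<p = ≤-pred (≰⇒> p≰2l)
      exponent≡0 : primeExponent a₂ l p ≡ 0
      exponent≡0 with does (p ∣? ∣ a₂ ∣)
      ... | true  = legendre-< p l (≤-<-trans (m≤n*m l 2) 2l<p)
      ... | false = legendre-< p (2 * l) 2l<p


module NewtonInterpolation where

  open import Data.Nat as ℕ using (ℕ; zero; suc; _^_; _<_; s≤s)
  open import Data.Nat.Properties using (+-suc; +-identityʳ; n<1+n; m≤n⇒m<n∨m≡n; <-trans)
  open import Data.Nat.Divisibility using () renaming (_∣_ to _∣ℕ_)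
  open import Data.Nat.Primality using (Prime)
  open import Data.Integer using (ℤ; +_; 0ℤ; 1ℤ; _+_; _-_; _*_; ∣_∣)
  open import Data.Integer.Properties using (abs-*; *-zeroʳ; *-zeroˡ; +-inverseʳ; *-identityˡ; i-j≡0⇒i≡j)
  open import Data.Integer.Divisibility.Signed using (_∣_; ∣ᵤ⇒∣; ∣⇒∣ᵤ; ∣m∣n⇒∣m-n)
  open import Data.Integer.Tactic.RingSolver using (solve-∀)
  open import Data.Product using (Σ; _,_; proj₁; proj₂)
  open import Data.Sum using (inj₁; inj₂)
  open import Relation.Binary.PropositionalEquality
  open Valuation

  module _ (a : ℕ → ℤ) where

    prodDiff-vanish : ∀ {i j} → i < j → prodDiff a j (a i) ≡ 0ℤ
    prodDiff-vanish {i} {suc j} (s≤s i≤j) with m≤n⇒m<n∨m≡n i≤j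
    ... | inj₁ i<j  = trans (cong (_* (a i - a j)) (prodDiff-vanish i<j)) (*-zeroˡ (a i - a j))
    ... | inj₂ refl = trans (cong (prodDiff a i (a i) *_) (+-inverseʳ (a i))) (*-zeroʳ (prodDiff a i (a i)))

    -- F = c_j P_j + ⋯ + c_{j+m-1} P_{j+m-1} + d P_{j+m}  for some c's, where P_i = prodDiff a i
    NewtonForm : ℕ → ℕ → ℤ → (ℤ → ℤ) → Set
    NewtonForm j zero    d F = ∀ x → F x ≡ d * prodDiff a j x
    NewtonForm j (suc m) d F = Σ ℤ λ c → NewtonForm (suc j) m d (λ x → F x - c * prodDiff a j x)

    newtonForm-cong : ∀ {j m d F G} → (∀ x → F x ≡ G x) → NewtonForm j m d F → NewtonForm j m d G
    newtonForm-cong {m = zero}  F≗G hF x = trans (sym (F≗G x)) (hF x)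
    newtonForm-cong {m = suc m} F≗G (c , hF) = c , newtonForm-cong (λ x → cong (_- _) (F≗G x)) hF

    -- (x - c) P_i = P_{i+1} + (a_i - c) P_i
    newtonForm-*-sub : ∀ {j m d F} → NewtonForm j m d F → ∀ c →
                       NewtonForm j (suc m) d (λ x → F x * (x - c))
    newtonForm-*-sub {j} {zero} {d} {F} hF c =
      d * (a j - c) , λ x → trans (cong (λ y → y * (x - c) - _) (hF x)) (shift d (prodDiff a j x) x (a j) c)
      where
      shift : ∀ d P x a c → d * P * (x - c) - d * (a - c) * P ≡ d * (P * (x - a))
      shift = solve-∀
    newtonForm-*-sub {j} {suc m} {d} {F} (c′ , hF) c with newtonForm-*-sub hF c
    ... | c₁ , hG =
      c′ * (a j - c) , c₁ + c′ , newtonForm-cong (λ x → shift (F x) c′ (prodDiff a j x) x (a j) c c₁) hG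
      where
      shift : ∀ F c′ P x a c c₁ → (F - c′ * P) * (x - c) - c₁ * (P * (x - a))
                                   ≡ F * (x - c) - c′ * (a - c) * P - (c₁ + c′) * (P * (x - a))
      shift = solve-∀

    prodDiff-newtonForm : ∀ c n → NewtonForm 0 n 1ℤ (prodDiff c n)
    prodDiff-newtonForm c zero    x = refl
    prodDiff-newtonForm c (suc n) = newtonForm-*-sub (prodDiff-newtonForm c n) (c n)

    newtonForm-vanish : ∀ {j m d F} → NewtonForm j m d F → ∀ {i} → i < j → F (a i) ≡ 0ℤ
    newtonForm-vanish {j} {zero} {d} hF {i} i<j =
      trans (hF (a i)) (trans (cong (d *_) (prodDiff-vanish i<j)) (*-zeroʳ d))
    newtonForm-vanish {j} {suc m} {F = F} (c , hF) {i} i<j =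
      trans (sym (drop (F (a i)) c)) (trans (cong (λ P → F (a i) - c * P) (sym (prodDiff-vanish i<j)))
            (newtonForm-vanish hF (<-trans i<j (n<1+n j))))
      where
      drop : ∀ y c → y - c * 0ℤ ≡ y
      drop = solve-∀

  module _ {p : ℕ} {S : ℤSet} {a : ℕ → ℤ} (pr : Prime p) (a-ordering : IsPOrdering p S a) where

    private
      a∈S : ∀ n → S (a n)
      a∈S = proj₁ a-ordering

      minimal : ∀ n x → S x → ∣ prodDiff a n (a n) ∣ ≼[ p ] ∣ prodDiff a n x ∣
      minimal = proj₂ a-ordering

      minimal-* : ∀ e c i {x} → S x → + (p ^ e) ∣ c * prodDiff a i (a i) → + (p ^ e) ∣ c * prodDiff a i x
      minimal-* e c i {x} x∈S p^e∣cPᵢ = ∣ᵤ⇒∣ (subst (p ^ e ∣ℕ_) (sym (abs-* c (prodDiff a i x)))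
        (*-monoʳ-≼ pr ∣ c ∣ (minimal i x x∈S) e
          (subst (p ^ e ∣ℕ_) (abs-* c (prodDiff a i (a i))) (∣⇒∣ᵤ p^e∣cPᵢ))))

    -- The coefficients are peeled off from the bottom: at a_j all higher P_i vanish.
    newtonForm-∣ : ∀ e {j m d F} → NewtonForm a j m d F → (∀ x → S x → + (p ^ e) ∣ F x) →
                   + (p ^ e) ∣ d * prodDiff a (m ℕ.+ j) (a (m ℕ.+ j))
    newtonForm-∣ e {j} {zero} hF F∣ = subst (_ ∣_) (hF (a j)) (F∣ (a j) (a∈S j))
    newtonForm-∣ e {j} {suc m} {d} {F} (c , hF) F∣ =
      subst (λ n → + (p ^ e) ∣ d * prodDiff a n (a n)) (+-suc m j) (newtonForm-∣ e hF rest∣)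
      where
      cPⱼ∣ : + (p ^ e) ∣ c * prodDiff a j (a j)
      cPⱼ∣ = subst (_ ∣_) (i-j≡0⇒i≡j _ _ (newtonForm-vanish a hF (n<1+n j))) (F∣ (a j) (a∈S j))
      rest∣ : ∀ x → S x → + (p ^ e) ∣ F x - c * prodDiff a j x
      rest∣ x x∈S = ∣m∣n⇒∣m-n (F∣ x x∈S) (minimal-* e c j x∈S cPⱼ∣)

    pOrdering-lower-bound : ∀ (c : ℕ → ℤ) n e → (∀ x → S x → p ^ e ∣ℕ ∣ prodDiff c n x ∣) →
                            p ^ e ∣ℕ ∣ prodDiff a n (a n) ∣
    pOrdering-lower-bound c n e c∣ = subst (λ k → p ^ e ∣ℕ ∣ prodDiff a k (a k) ∣) (+-identityʳ n)
      (subst (λ y → p ^ e ∣ℕ ∣ y ∣) (*-identityˡ (prodDiff a (n ℕ.+ 0) (a (n ℕ.+ 0))))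
        (∣⇒∣ᵤ (newtonForm-∣ e (prodDiff-newtonForm a c n) λ x x∈S → ∣ᵤ⇒∣ (c∣ x x∈S))))


module DivisibilityOrderings where

  open import Data.Nat as ℕ using (ℕ; zero; suc; _!; s≤s; z≤n)
  import Data.Nat.Properties as ℕ
  open import Data.Nat.Divisibility using (_∣0; 1∣_) renaming (_∣_ to _∣ℕ_; ∣-trans to ∣ℕ-trans)
  import Data.Nat.Divisibility as ℕ using (*-cancelˡ-∣)
  open import Data.Integer using (ℤ; +_; -[1+_]; 1ℤ; _+_; _-_; _*_; ∣_∣)
  open import Data.Integer.Properties using (pos-*; abs-*)
  open import Data.Integer.Divisibility.Signed
    using (_∣_; ∣ᵤ⇒∣; ∣⇒∣ᵤ; ∣m∣n⇒∣m+n; ∣m+n∣n⇒∣m; *-monoʳ-∣)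
  open import Data.Integer.Tactic.RingSolver using (solve-∀)
  open import Data.Product using (_,_)
  open import Function using (id; _∘_)
  open import Relation.Binary.PropositionalEquality
  open ≡-Reasoning
  open NewtonInterpolation using (prodDiff-vanish)

  divisibility⇒pOrdering : ∀ {S a} → (∀ n → S (a n)) →
    (∀ n x → S x → ∣ prodDiff a n (a n) ∣ ∣ℕ ∣ prodDiff a n x ∣) → ∀ p → IsPOrdering p S a
  divisibility⇒pOrdering a∈S a∣ p = a∈S , λ n x x∈S e p^e∣ → ∣ℕ-trans p^e∣ (a∣ n x x∈S)

  falling : ℕ → ℤ → ℤ
  falling = prodDiff (+_)

  falling-suc : ∀ n x → falling (suc n) (1ℤ + x) ≡ (1ℤ + x) * falling n x
  falling-suc zero    x = shift x
    where
    shift : ∀ x → 1ℤ * (1ℤ + x - + 0) ≡ (1ℤ + x) * 1ℤ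
    shift = solve-∀
  falling-suc (suc n) x =
    trans (cong (_* (1ℤ + x - (1ℤ + + n))) (falling-suc n x)) (shift (1ℤ + x) (falling n x) x (+ n))
    where
    shift : ∀ y F x n → y * F * (1ℤ + x - (1ℤ + n)) ≡ y * (F * (x - n))
    shift = solve-∀

  falling-self : ∀ n → falling n (+ n) ≡ + (n !)
  falling-self zero    = refl
  falling-self (suc n) = begin
    falling (suc n) (+ suc n)     ≡⟨ falling-suc n (+ n) ⟩
    + suc n * falling n (+ n)     ≡⟨ cong (+ suc n *_) (falling-self n) ⟩
    + suc n * + (n !)             ≡⟨ pos-* (suc n) (n !) ⟨
    + (suc n !)                   ∎

  falling-pascal : ∀ n x → falling (suc n) (1ℤ + x) ≡ falling (suc n) x + + suc n * falling n x
  falling-pascal n x = trans (falling-suc n x) (shift x (falling n x) (+ n))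
    where
    shift : ∀ x F n → (1ℤ + x) * F ≡ F * (x - n) + (1ℤ + n) * F
    shift = solve-∀

  !∣falling : ∀ n x → + (n !) ∣ falling n x
  !∣falling zero    x = ∣ᵤ⇒∣ (1∣ _)
  !∣falling (suc n) = go
    where
    step∣ : ∀ y → + (suc n !) ∣ + suc n * falling n y
    step∣ y = subst (_∣ + suc n * falling n y) (sym (pos-* (suc n) (n !)))
                (*-monoʳ-∣ (+ suc n) (!∣falling n y))
    -- by falling-pascal, divisibility propagates from 0 in both directions
    go : ∀ x → + (suc n !) ∣ falling (suc n) x
    go (+ zero)     = subst (+ (suc n !) ∣_) (sym (prodDiff-vanish (+_) {0} {suc n} (s≤s z≤n)))
                        (∣ᵤ⇒∣ ((suc n !) ∣0))
    go (+ suc k)    = subst (+ (suc n !) ∣_) (sym (falling-pascal n (+ k)))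
                        (∣m∣n⇒∣m+n (go (+ k)) (step∣ (+ k)))
    go -[1+ zero ]  = ∣m+n∣n⇒∣m (subst (+ (suc n !) ∣_) (falling-pascal n -[1+ 0 ]) (go (+ 0)))
                        (step∣ -[1+ 0 ])
    go -[1+ suc k ] = ∣m+n∣n⇒∣m (subst (+ (suc n !) ∣_) (falling-pascal n -[1+ suc k ]) (go -[1+ k ]))
                        (step∣ -[1+ suc k ])

  natural-pOrdering : ∀ p → IsPOrdering p (image id) (+_)
  natural-pOrdering = divisibility⇒pOrdering (λ n → + n , refl) λ n x _ →
    subst (λ y → ∣ y ∣ ∣ℕ ∣ falling n x ∣) (sym (falling-self n)) (∣⇒∣ᵤ (!∣falling n x))

  pronic : ℤ → ℤ
  pronic w = w * (w + 1ℤ)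

  pronic-falling : ∀ n W → prodDiff (pronic ∘ +_) n (pronic W) ≡ falling (2 ℕ.* n) (W + + n)
  pronic-falling zero    W = refl
  pronic-falling (suc n) W = begin
    prodDiff (pronic ∘ +_) n (pronic W) * (pronic W - pronic (+ n))
      ≡⟨ cong (_* (pronic W - pronic (+ n))) (pronic-falling n W) ⟩
    falling (2 ℕ.* n) (W + + n) * (pronic W - pronic (+ n))
      ≡⟨ factor (falling (2 ℕ.* n) (W + + n)) W (+ n) ⟩
    (1ℤ + (W + + n)) * (falling (2 ℕ.* n) (W + + n) * (W + + n - + 2 * + n))
      ≡⟨ cong (λ k → (1ℤ + (W + + n)) * (falling (2 ℕ.* n) (W + + n) * (W + + n - k))) (pos-* 2 n) ⟨
    (1ℤ + (W + + n)) * falling (suc (2 ℕ.* n)) (W + + n)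
      ≡⟨ falling-suc (suc (2 ℕ.* n)) (W + + n) ⟨
    falling (suc (suc (2 ℕ.* n))) (1ℤ + (W + + n))
      ≡⟨ cong₂ falling (ℕ.*-suc 2 n) (W+1+n W (+ n)) ⟨
    falling (2 ℕ.* suc n) (W + + suc n)
      ∎
    where
    factor : ∀ F W n → F * (W * (W + 1ℤ) - n * (n + 1ℤ)) ≡ (1ℤ + (W + n)) * (F * (W + n - + 2 * n))
    factor = solve-∀
    W+1+n : ∀ W n → W + (1ℤ + n) ≡ 1ℤ + (W + n)
    W+1+n = solve-∀

  pronic-self : ∀ n → prodDiff (pronic ∘ +_) n (pronic (+ n)) ≡ + ((2 ℕ.* n) !)
  pronic-self n = begin
    prodDiff (pronic ∘ +_) n (pronic (+ n))
      ≡⟨ pronic-falling n (+ n) ⟩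
    falling (2 ℕ.* n) (+ (n ℕ.+ n))
      ≡⟨ cong (λ k → falling (2 ℕ.* n) (+ (n ℕ.+ k))) (ℕ.+-identityʳ n) ⟨
    falling (2 ℕ.* n) (+ (2 ℕ.* n))
      ≡⟨ falling-self (2 ℕ.* n) ⟩
    + ((2 ℕ.* n) !)
      ∎

  pronic-pOrdering : ∀ p → IsPOrdering p (image pronic) (pronic ∘ +_)
  pronic-pOrdering = divisibility⇒pOrdering (λ n → + n , refl) λ where
    n x (W , refl) → subst₂ (λ u v → ∣ u ∣ ∣ℕ ∣ v ∣) (sym (pronic-self n)) (sym (pronic-falling n W))
                       (∣⇒∣ᵤ (!∣falling (2 ℕ.* n) (W + + n)))

  square : ℤ → ℤ
  square w = w * w

  square-falling : ∀ m W → prodDiff (square ∘ +_) (suc m) (square W) ≡ W * falling (suc (2 ℕ.* m)) (W + + m)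
  square-falling zero    W = base W
    where
    base : ∀ W → 1ℤ * (W * W - + 0 * + 0) ≡ W * (1ℤ * (W + + 0 - + 0))
    base = solve-∀
  square-falling (suc m) W = begin
    prodDiff (square ∘ +_) (suc m) (square W) * (square W - square (+ suc m))
      ≡⟨ cong (_* (square W - square (+ suc m))) (square-falling m W) ⟩
    W * F * (W * W - + suc m * + suc m)
      ≡⟨ factor W F (+ m) ⟩
    W * ((1ℤ + (W + + m)) * (F * (W + + m - (1ℤ + + 2 * + m))))
      ≡⟨ cong (λ k → W * ((1ℤ + (W + + m)) * (F * (W + + m - (1ℤ + k))))) (pos-* 2 m) ⟨
    W * ((1ℤ + (W + + m)) * falling (suc (suc (2 ℕ.* m))) (W + + m))
      ≡⟨ cong (W *_) (falling-suc (suc (suc (2 ℕ.* m))) (W + + m)) ⟨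
    W * falling (suc (suc (suc (2 ℕ.* m)))) (1ℤ + (W + + m))
      ≡⟨ cong₂ (λ k y → W * falling (suc k) y) (ℕ.*-suc 2 m) (W+1+m W (+ m)) ⟨
    W * falling (suc (2 ℕ.* suc m)) (W + + suc m)
      ∎
    where
    F : ℤ
    F = falling (suc (2 ℕ.* m)) (W + + m)
    factor : ∀ W F m → W * F * (W * W - (1ℤ + m) * (1ℤ + m)) ≡
                      W * ((1ℤ + (W + m)) * (F * (W + m - (1ℤ + + 2 * m))))
    factor = solve-∀
    W+1+m : ∀ W m → W + (1ℤ + m) ≡ 1ℤ + (W + m)
    W+1+m = solve-∀

  square-self : ∀ m → prodDiff (square ∘ +_) (suc m) (square (+ suc m)) ≡ + (suc m ℕ.* suc (2 ℕ.* m) !)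
  square-self m = begin
    prodDiff (square ∘ +_) (suc m) (square (+ suc m))
      ≡⟨ square-falling m (+ suc m) ⟩
    + suc m * falling (suc (2 ℕ.* m)) (+ suc (m ℕ.+ m))
      ≡⟨ cong (λ k → + suc m * falling (suc (2 ℕ.* m)) (+ suc (m ℕ.+ k))) (ℕ.+-identityʳ m) ⟨
    + suc m * falling (suc (2 ℕ.* m)) (+ suc (2 ℕ.* m))
      ≡⟨ cong (+ suc m *_) (falling-self (suc (2 ℕ.* m))) ⟩
    + suc m * + (suc (2 ℕ.* m) !)
      ≡⟨ pos-* (suc m) (suc (2 ℕ.* m) !) ⟨
    + (suc m ℕ.* suc (2 ℕ.* m) !)
      ∎

  2*[1+m]*[1+2m]!≡[2+2m]! : ∀ m → 2 ℕ.* (suc m ℕ.* suc (2 ℕ.* m) !) ≡ (2 ℕ.* suc m) !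
  2*[1+m]*[1+2m]!≡[2+2m]! m = begin
    2 ℕ.* (suc m ℕ.* suc (2 ℕ.* m) !)  ≡⟨ ℕ.*-assoc 2 (suc m) _ ⟨
    2 ℕ.* suc m ℕ.* suc (2 ℕ.* m) !    ≡⟨ cong (ℕ._* suc (2 ℕ.* m) !) (ℕ.*-suc 2 m) ⟩
    suc (suc (2 ℕ.* m)) !              ≡⟨ cong _! (ℕ.*-suc 2 m) ⟨
    (2 ℕ.* suc m) !                    ∎

  2*∣square-self∣ : ∀ {l} → 1 ℕ.≤ l →
                    2 ℕ.* ∣ prodDiff (square ∘ +_) l (square (+ l)) ∣ ≡ (2 ℕ.* l) !
  2*∣square-self∣ {suc m} _ =
    trans (cong (λ z → 2 ℕ.* ∣ z ∣) (square-self m)) (2*[1+m]*[1+2m]!≡[2+2m]! m)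

  -- 2 W F(2m+1, W+m) = F(2m+2, W+m+1) + F(2m+2, W+m), and (2m+2)! divides both
  square-∣ : ∀ m W → suc m ℕ.* suc (2 ℕ.* m) ! ∣ℕ ∣ W * falling (suc (2 ℕ.* m)) (W + + m) ∣
  square-∣ m W = ℕ.*-cancelˡ-∣ 2
    (subst₂ _∣ℕ_ (sym (2*[1+m]*[1+2m]!≡[2+2m]! m)) (abs-* (+ 2) X) (∣⇒∣ᵤ [2+2m]!∣2X))
    where
    y F X : ℤ
    y = W + + m
    F = falling (suc (2 ℕ.* m)) y
    X = W * F
    sum : ∀ W m F → (1ℤ + (W + m)) * F + F * (W + m - (1ℤ + + 2 * m)) ≡ + 2 * (W * F)
    sum = solve-∀
    two-X : + 2 * X ≡ falling (suc (suc (2 ℕ.* m))) (1ℤ + y) + falling (suc (suc (2 ℕ.* m))) y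
    two-X = begin
      + 2 * X
        ≡⟨ sum W (+ m) F ⟨
      (1ℤ + y) * F + F * (y - (1ℤ + + 2 * + m))
        ≡⟨ cong₂ _+_ (falling-suc (suc (2 ℕ.* m)) y) (cong (λ k → F * (y - (1ℤ + k))) (pos-* 2 m)) ⟨
      falling (suc (suc (2 ℕ.* m))) (1ℤ + y) + falling (suc (suc (2 ℕ.* m))) y
        ∎
    [2+2m]!∣2X : + ((2 ℕ.* suc m) !) ∣ + 2 * X
    [2+2m]!∣2X = subst (λ k → + (k !) ∣ + 2 * X) (sym (ℕ.*-suc 2 m)) (subst (+ _ ∣_) (sym two-X)
      (∣m∣n⇒∣m+n (!∣falling (suc (suc (2 ℕ.* m))) (1ℤ + y)) (!∣falling (suc (suc (2 ℕ.* m))) y)))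

  square-pOrdering : ∀ p → IsPOrdering p (image square) (square ∘ +_)
  square-pOrdering = divisibility⇒pOrdering (λ n → + n , refl) λ where
    zero    x _        → 1∣ _
    (suc m) x (W , refl) →
      subst₂ (λ u v → ∣ u ∣ ∣ℕ ∣ v ∣) (sym (square-self m)) (sym (square-falling m W)) (square-∣ m W)


module Congruence where

  open import Data.Nat as ℕ using (ℕ; zero; suc; _^_)
  open import Data.Nat.Coprimality using (Coprime; coprime-Bézout; coprime-divisor)
  open import Data.Nat.Primality using (Prime; prime⇒irreducible)
  open import Data.Nat.GCD using (module Bézout)
  open import Data.Nat.Divisibility using (∣-trans; ∣1⇒≡1) renaming (_∣_ to _∣ℕ_)
  open import Data.Integer using (ℤ; +_; -[1+_]; 1ℤ; _+_; _-_; _*_; -_; ∣_∣)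
  open import Data.Integer.Properties using (pos-+; pos-*; +-inverseʳ; *-comm; neg-distribˡ-*)
  open import Data.Integer.Divisibility.Signed
    using (_∣_; divides; ∣ᵤ⇒∣; ∣⇒∣ᵤ; ∣m∣n⇒∣m+n; ∣m∣n⇒∣m-n; ∣m⇒∣-m; ∣m⇒∣m*n; ∣n⇒∣m*n)
  open import Data.Integer.Tactic.RingSolver using (solve-∀)
  open import Data.Product using (∃; _,_)
  open import Data.Sum using (inj₁; inj₂)
  open import Data.Empty using (⊥-elim)
  open import Relation.Nullary using (¬_)
  open import Relation.Binary.PropositionalEquality

  infix 4 _≡_[mod_]
  record _≡_[mod_] (x y : ℤ) (M : ℕ) : Set where
    constructor congruent
    field ∣-difference : + M ∣ x - y

  open _≡_[mod_] public

  private
    toℤ : ∀ {a b c d e} → a ℕ.+ b ℕ.* c ≡ d ℕ.* e → + a + + b * + c ≡ + d * + e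
    toℤ {a} {b} {c} {d} {e} eq = trans (cong (λ z → + a + z) (sym (pos-* b c)))
      (trans (sym (pos-+ a (b ℕ.* c))) (trans (cong +_ eq) (pos-* d e)))

  module _ {M : ℕ} where

    ≡[mod]-refl : ∀ x → x ≡ x [mod M ]
    ≡[mod]-refl x = congruent (divides (+ 0) (+-inverseʳ x))

    ≡[mod]-sym : ∀ {x y} → x ≡ y [mod M ] → y ≡ x [mod M ]
    ≡[mod]-sym {x} {y} (congruent M∣x-y) = congruent (subst (+ M ∣_) (flip x y) (∣m⇒∣-m M∣x-y))
      where
      flip : ∀ x y → - (x - y) ≡ y - x
      flip = solve-∀

    ≡[mod]-*-cong : ∀ {x x′ y y′} → x ≡ x′ [mod M ] → y ≡ y′ [mod M ] →
                    x * y ≡ x′ * y′ [mod M ]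
    ≡[mod]-*-cong {x} {x′} {y} {y′} (congruent x≡x′) (congruent y≡y′) = congruent
      (subst (+ M ∣_) (split x x′ y y′) (∣m∣n⇒∣m+n (∣n⇒∣m*n x y≡y′) (∣m⇒∣m*n y′ x≡x′)))
      where
      split : ∀ x x′ y y′ → x * (y - y′) + (x - x′) * y′ ≡ x * y - x′ * y′
      split = solve-∀

    ≡[mod]-+-cong : ∀ {x x′ y y′} → x ≡ x′ [mod M ] → y ≡ y′ [mod M ] →
                    x + y ≡ x′ + y′ [mod M ]
    ≡[mod]-+-cong {x} {x′} {y} {y′} (congruent x≡x′) (congruent y≡y′) =
      congruent (subst (+ M ∣_) (split x x′ y y′) (∣m∣n⇒∣m+n x≡x′ y≡y′))
      where
      split : ∀ x x′ y y′ → (x - x′) + (y - y′) ≡ (x + y) - (x′ + y′)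
      split = solve-∀

    ≡[mod]-−-cong : ∀ {x x′ y y′} → x ≡ x′ [mod M ] → y ≡ y′ [mod M ] →
                    x - y ≡ x′ - y′ [mod M ]
    ≡[mod]-−-cong {x} {x′} {y} {y′} (congruent x≡x′) (congruent y≡y′) =
      congruent (subst (+ M ∣_) (split x x′ y y′) (∣m∣n⇒∣m-n x≡x′ y≡y′))
      where
      split : ∀ x x′ y y′ → (x - x′) - (y - y′) ≡ (x - y) - (x′ - y′)
      split = solve-∀

    ∣-resp-≡[mod] : ∀ {x y} → x ≡ y [mod M ] → M ∣ℕ ∣ x ∣ → M ∣ℕ ∣ y ∣
    ∣-resp-≡[mod] {x} {y} (congruent x≡y) M∣x =
      ∣⇒∣ᵤ (subst (+ M ∣_) (cancel x y) (∣m∣n⇒∣m-n (∣ᵤ⇒∣ {+ M} {x} M∣x) x≡y))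
      where
      cancel : ∀ x y → x - (x - y) ≡ y
      cancel = solve-∀

    prodDiff-cong : ∀ {c c′ X X′} → (∀ k → c k ≡ c′ k [mod M ]) → X ≡ X′ [mod M ] →
                    ∀ n → prodDiff c n X ≡ prodDiff c′ n X′ [mod M ]
    prodDiff-cong c≡c′ X≡X′ zero    = ≡[mod]-refl 1ℤ
    prodDiff-cong c≡c′ X≡X′ (suc n) =
      ≡[mod]-*-cong (prodDiff-cong c≡c′ X≡X′ n) (≡[mod]-−-cong X≡X′ (c≡c′ n))

  prime∤⇒coprime : ∀ {p n} → Prime p → ¬ p ∣ℕ n → Coprime p n
  prime∤⇒coprime pr p∤n (d∣p , d∣n) with prime⇒irreducible pr d∣p
  ... | inj₁ d≡1  = d≡1
  ... | inj₂ refl = ⊥-elim (p∤n d∣n)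

  coprime-^ : ∀ {m n} → Coprime m n → ∀ e → Coprime (m ^ e) n
  coprime-^ m⊥n zero    (i∣1 , _)          = ∣1⇒≡1 i∣1
  coprime-^ m⊥n (suc e) (i∣m*m^e , i∣n) = coprime-^ m⊥n e (coprime-divisor i⊥m i∣m*m^e , i∣n)
    where
    i⊥m : Coprime _ _
    i⊥m (d∣i , d∣m) = m⊥n (d∣m , ∣-trans d∣i i∣n)

  coprime⇒invertible : ∀ {M} a → Coprime M ∣ a ∣ → ∃ λ u → a * u ≡ 1ℤ [mod M ]
  coprime⇒invertible {M} (+ n) M⊥n with coprime-Bézout M⊥n
  ... | Bézout.+- x y 1+yn≡xM = - + y , congruent (divides (- + x) (trans (negate (+ n) (+ y))
          (trans (cong -_ (toℤ {1} {y} {n} {x} {M} 1+yn≡xM)) (neg-distribˡ-* (+ x) (+ M)))))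
    where
    negate : ∀ n y → n * - y - 1ℤ ≡ - (1ℤ + y * n)
    negate = solve-∀
  ... | Bézout.-+ x y 1+xM≡yn = + y , congruent (divides (+ x) (trans
          (cong (_- 1ℤ) (trans (*-comm (+ n) (+ y)) (sym (toℤ {1} {x} {M} {y} {n} 1+xM≡yn))))
          (cancel (+ x * + M))))
    where
    cancel : ∀ z → 1ℤ + z - 1ℤ ≡ z
    cancel = solve-∀
  coprime⇒invertible {M} -[1+ k ] M⊥n with coprime⇒invertible (+ suc k) M⊥n
  ... | u , congruent M∣ku-1 =
    - u , congruent (subst (λ v → + M ∣ v - 1ℤ) (neg-swap (+ suc k) u) M∣ku-1)
    where
    neg-swap : ∀ k u → k * u ≡ - k * - u
    neg-swap = solve-∀

  affine-onto : ∀ {M} a → Coprime M ∣ a ∣ → ∀ h z → ∃ λ y → a * y + h ≡ z [mod M ]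
  affine-onto {M} a M⊥a h z with coprime⇒invertible a M⊥a
  ... | u , congruent M∣au-1 =
    u * (z - h) , congruent (subst (+ M ∣_) (shift a u z h) (∣m⇒∣m*n (z - h) M∣au-1))
    where
    shift : ∀ a u z h → (a * u - 1ℤ) * (z - h) ≡ a * (u * (z - h)) + h - z
    shift = solve-∀


module ValuationTransport where

  open import Data.Nat as ℕ using (ℕ; zero; suc; _^_)
  import Data.Nat.Properties as ℕ
  open import Data.Nat.Divisibility
    using (∣-trans; ∣-reflexive; ∣n⇒∣m*n; ∣m⇒∣m*n; *-pres-∣) renaming (_∣_ to _∣ℕ_)
  open import Data.Nat.Primality using (Prime)
  open import Data.Nat.Tactic.RingSolver using (solve-∀)
  open import Data.Integer using (ℤ; +_; _+_; _-_; _*_; ∣_∣)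
  open import Data.Integer.Properties using (abs-*)
  open import Data.Product using (∃; _,_; proj₁; proj₂)
  open import Function using (_∘_)
  open import Relation.Nullary using (¬_)
  open import Relation.Binary.PropositionalEquality
  open ≡-Reasoning
  open import Algebra.Properties.CommutativeSemigroup ℕ.*-commutativeSemigroup using (interchange)
  open Valuation
  open NewtonInterpolation using (pOrdering-lower-bound)
  open Congruence

  prodBelow-factor : ∀ {κ A B C : ℕ → ℕ} g → (∀ k → κ k ℕ.* A k ≡ g ℕ.* (B k ℕ.* C k)) →
    ∀ n → prodBelow κ n ℕ.* prodBelow A n ≡ g ^ n ℕ.* (prodBelow B n ℕ.* prodBelow C n)
  prodBelow-factor g factor zero = refl
  prodBelow-factor {κ} {A} {B} {C} g factor (suc n) = begin
    prodBelow κ n ℕ.* κ n ℕ.* (prodBelow A n ℕ.* A n)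
      ≡⟨ interchange (prodBelow κ n) (κ n) (prodBelow A n) (A n) ⟩
    prodBelow κ n ℕ.* prodBelow A n ℕ.* (κ n ℕ.* A n)
      ≡⟨ cong₂ ℕ._*_ (prodBelow-factor g factor n) (factor n) ⟩
    g ^ n ℕ.* (prodBelow B n ℕ.* prodBelow C n) ℕ.* (g ℕ.* (B n ℕ.* C n))
      ≡⟨ regroup (g ^ n) g (prodBelow B n) (prodBelow C n) (B n) (C n) ⟩
    g ℕ.* g ^ n ℕ.* (prodBelow B n ℕ.* B n ℕ.* (prodBelow C n ℕ.* C n))
      ∎
    where
    regroup : ∀ G g X Y b c →
              G ℕ.* (X ℕ.* Y) ℕ.* (g ℕ.* (b ℕ.* c)) ≡ g ℕ.* G ℕ.* (X ℕ.* b ℕ.* (Y ℕ.* c))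
    regroup = solve-∀

  abs-prodDiff : ∀ c n x → ∣ prodDiff c n x ∣ ≡ prodBelow (λ k → ∣ x - c k ∣) n
  abs-prodDiff c zero    x = refl
  abs-prodDiff c (suc n) x =
    trans (abs-* (prodDiff c n x) (x - c n)) (cong (ℕ._* ∣ x - c n ∣) (abs-prodDiff c n x))

  prodDiff-≗ : ∀ {c c′} → (∀ k → c k ≡ c′ k) → ∀ n x → prodDiff c n x ≡ prodDiff c′ n x
  prodDiff-≗ c≗c′ zero    x = refl
  prodDiff-≗ c≗c′ (suc n) x = cong₂ (λ P c → P * (x - c)) (prodDiff-≗ c≗c′ n x) (c≗c′ n)

  -- If κ (f y − f c) = g (m (W y) − m (W c)) ε(y, c) with p-adic units κ, ε and W is onto modulo every
  -- power of p, then v_p(l; f(ℤ)) = v_p(g^l) + v_p(l; m(ℤ)).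
  module _ {p : ℕ} (pr : Prime p) {f m W : ℤ → ℤ} {κ : ℤ} {ε : ℤ → ℤ → ℤ} {g : ℕ}
           (factor : ∀ y c → κ * (f y - f c) ≡ + g * ((m (W y) - m (W c)) * ε y c))
           (p∤κ : ¬ p ∣ℕ ∣ κ ∣) (p∤ε : ∀ y c → ¬ p ∣ℕ ∣ ε y c ∣)
           (m-cong : ∀ {M x y} → x ≡ y [mod M ] → m x ≡ m y [mod M ])
           (W-onto : ∀ e z → ∃ λ y → W y ≡ z [mod p ^ e ])
           {a a′ : ℕ → ℤ} (a-ordering : IsPOrdering p (image f) a)
           (a′-ordering : IsPOrdering p (image m) a′)
           (l : ℕ) where

    private
      Πκ : ℕ
      Πκ = prodBelow (λ _ → ∣ κ ∣) l

      Πε : ℤ → (ℕ → ℤ) → ℕ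
      Πε y c = prodBelow (λ k → ∣ ε y (c k) ∣) l

      Πκ-unit : HasValuation p Πκ 0
      Πκ-unit = valuation-prodBelow-0 pr l λ _ _ → valuation-∤ pr p∤κ

      Πε-unit : ∀ y c → HasValuation p (Πε y c) 0
      Πε-unit y c = valuation-prodBelow-0 pr l λ k _ → valuation-∤ pr (p∤ε y (c k))

      product-factor : ∀ (c : ℕ → ℤ) y → Πκ ℕ.* ∣ prodDiff (f ∘ c) l (f y) ∣
                       ≡ g ^ l ℕ.* (∣ prodDiff (m ∘ W ∘ c) l (m (W y)) ∣ ℕ.* Πε y c)
      product-factor c y = begin
        Πκ ℕ.* ∣ prodDiff (f ∘ c) l (f y) ∣
          ≡⟨ cong (Πκ ℕ.*_) (abs-prodDiff (f ∘ c) l (f y)) ⟩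
        Πκ ℕ.* prodBelow (λ k → ∣ f y - f (c k) ∣) l
          ≡⟨ prodBelow-factor g factor-abs l ⟩
        g ^ l ℕ.* (prodBelow (λ k → ∣ m (W y) - m (W (c k)) ∣) l ℕ.* Πε y c)
          ≡⟨ cong (λ Q → g ^ l ℕ.* (Q ℕ.* Πε y c)) (abs-prodDiff (m ∘ W ∘ c) l (m (W y))) ⟨
        g ^ l ℕ.* (∣ prodDiff (m ∘ W ∘ c) l (m (W y)) ∣ ℕ.* Πε y c)
          ∎
        where
        factor-abs : ∀ k → ∣ κ ∣ ℕ.* ∣ f y - f (c k) ∣
                           ≡ g ℕ.* (∣ m (W y) - m (W (c k)) ∣ ℕ.* ∣ ε y (c k) ∣)
        factor-abs k = begin
          ∣ κ ∣ ℕ.* ∣ f y - f (c k) ∣                          ≡⟨ abs-* κ _ ⟨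
          ∣ κ * (f y - f (c k)) ∣                              ≡⟨ cong ∣_∣ (factor y (c k)) ⟩
          ∣ + g * ((m (W y) - m (W (c k))) * ε y (c k)) ∣      ≡⟨ abs-* (+ g) _ ⟩
          g ℕ.* ∣ (m (W y) - m (W (c k))) * ε y (c k) ∣
            ≡⟨ cong (g ℕ.*_) (abs-* (m (W y) - m (W (c k))) (ε y (c k))) ⟩
          g ℕ.* (∣ m (W y) - m (W (c k)) ∣ ℕ.* ∣ ε y (c k) ∣)  ∎

    transport-≥ : ∀ {α s} → p ^ α ∣ℕ g ^ l → p ^ s ∣ℕ ∣ prodDiff a′ l (a′ l) ∣ →
                  p ^ (α ℕ.+ s) ∣ℕ ∣ prodDiff a l (a l) ∣
    transport-≥ {α} {s} p^α∣g^l p^s∣P′ =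
      pOrdering-lower-bound pr a-ordering (f ∘ c) l (α ℕ.+ s) λ { x (y , refl) → fc∣ y }
      where
      z : ℕ → ℤ
      z k = proj₁ (proj₁ a′-ordering k)
      c : ℕ → ℤ
      c k = proj₁ (W-onto s (z k))
      a′≡mWc : ∀ k → a′ k ≡ m (W (c k)) [mod p ^ s ]
      a′≡mWc k = subst (_≡ m (W (c k)) [mod p ^ s ]) (sym (proj₂ (proj₁ a′-ordering k)))
                   (≡[mod]-sym (m-cong (proj₂ (W-onto s (z k)))))
      mWc∣ : ∀ y → p ^ s ∣ℕ ∣ prodDiff (m ∘ W ∘ c) l (m (W y)) ∣
      mWc∣ y = ∣-resp-≡[mod] (prodDiff-cong a′≡mWc (≡[mod]-refl (m (W y))) l)
                 (proj₂ a′-ordering l (m (W y)) (W y , refl) s p^s∣P′)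
      fc∣ : ∀ y → p ^ (α ℕ.+ s) ∣ℕ ∣ prodDiff (f ∘ c) l (f y) ∣
      fc∣ y = valuation-∣-cancelˡ pr Πκ-unit (α ℕ.+ s)
        (subst (p ^ (α ℕ.+ s) ∣ℕ_) (sym (product-factor c y)) (∣-trans (∣-reflexive (ℕ.^-distribˡ-+-* p α s))
          (*-pres-∣ p^α∣g^l (∣m⇒∣m*n (Πε y c) (mWc∣ y)))))

    transport-≤ : ∀ {α s} → HasValuation p (g ^ l) α → p ^ (α ℕ.+ s) ∣ℕ ∣ prodDiff a l (a l) ∣ →
                  p ^ s ∣ℕ ∣ prodDiff a′ l (a′ l) ∣
    transport-≤ {α} {s} g^l-val p^[α+s]∣P =
      pOrdering-lower-bound pr a′-ordering (m ∘ W ∘ b) l s λ { x (z , refl) → mWb∣ z }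
      where
      b : ℕ → ℤ
      b k = proj₁ (proj₁ a-ordering k)
      fb∣ : ∀ y → p ^ (α ℕ.+ s) ∣ℕ ∣ prodDiff (f ∘ b) l (f y) ∣
      fb∣ y = subst (λ P → p ^ (α ℕ.+ s) ∣ℕ ∣ P ∣)
                (prodDiff-≗ (proj₂ ∘ proj₁ a-ordering) l (f y))
                (proj₂ a-ordering l (f y) (y , refl) (α ℕ.+ s) p^[α+s]∣P)
      mWb∣-at-W : ∀ y → p ^ s ∣ℕ ∣ prodDiff (m ∘ W ∘ b) l (m (W y)) ∣
      mWb∣-at-W y = valuation-∣-cancelˡ pr (Πε-unit y b) s (subst (p ^ s ∣ℕ_) (ℕ.*-comm _ (Πε y b))
        (valuation-∣-cancelˡ pr g^l-val s
          (subst (p ^ (α ℕ.+ s) ∣ℕ_) (product-factor b y) (∣n⇒∣m*n Πκ (fb∣ y)))))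
      mWb∣ : ∀ z → p ^ s ∣ℕ ∣ prodDiff (m ∘ W ∘ b) l (m z) ∣
      mWb∣ z = ∣-resp-≡[mod]
        (prodDiff-cong (λ k → ≡[mod]-refl (m (W (b k)))) (m-cong (proj₂ (W-onto s z))) l)
        (mWb∣-at-W (proj₁ (W-onto s z)))

    valuation-transport : ∀ {α t} → HasValuation p (g ^ l) α →
                          HasValuation p ∣ prodDiff a′ l (a′ l) ∣ t →
                          HasValuation p ∣ prodDiff a l (a l) ∣ (α ℕ.+ t)
    valuation-transport {α} {t} g^l-val P′-val = hasValuation
      (transport-≥ {α} {t} (p^t∣X g^l-val) (p^t∣X P′-val))
      λ p^[1+α+t]∣P → p^[1+t]∤X P′-val (transport-≤ g^l-val
        (subst (λ e → p ^ e ∣ℕ ∣ prodDiff a l (a l) ∣) (sym (ℕ.+-suc α t)) p^[1+α+t]∣P))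


module QuadraticImage where

  open import Data.Nat as ℕ using (ℕ; suc; _^_; NonZero)
  open import Data.Nat.Divisibility using () renaming (_∣_ to _∣ℕ_)
  open import Data.Nat.Primality using (Prime; prime⇒nonZero)
  open import Data.Integer using (ℤ; +_; 1ℤ; _+_; _-_; _*_; ∣_∣)
  open import Data.Integer.DivMod using (_%ℕ_; _/ℕ_; a≡a%ℕn+[a/ℕn]*n; n%ℕd<d)
  open import Data.Integer.Properties using (*-comm; +-identityˡ)
  import Data.Integer.Divisibility.Signed as ℤ
  open import Data.Integer.Tactic.RingSolver using (solve-∀)
  open import Data.Product using (∃; _,_)
  open import Data.Empty using (⊥-elim)
  open import Function using (id; _∘_)
  open import Relation.Nullary using (¬_)
  open import Relation.Binary.PropositionalEquality
  open Valuation
  open Legendre using (valuation-!)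
  open DivisibilityOrderings
  open Congruence
  open ValuationTransport using (valuation-transport)

  2∣⇒even : ∀ a → 2 ∣ℕ ∣ a ∣ → ∃ λ h → a ≡ + 2 * h
  2∣⇒even a 2∣a with ℤ.∣ᵤ⇒∣ {+ 2} {a} 2∣a
  ... | ℤ.divides h a≡h*2 = h , trans a≡h*2 (*-comm h (+ 2))

  ¬2∣⇒odd : ∀ a → ¬ 2 ∣ℕ ∣ a ∣ → ∃ λ h → a ≡ + 2 * h + 1ℤ
  ¬2∣⇒odd a 2∤a with a %ℕ 2 | a≡a%ℕn+[a/ℕn]*n a 2 | n%ℕd<d a 2
  ... | 0 | a≡0+h*2 | _ =
    ⊥-elim (2∤a (ℤ.∣⇒∣ᵤ {+ 2} (ℤ.divides (a /ℕ 2) (trans a≡0+h*2 (+-identityˡ _)))))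
  ... | 1 | a≡1+h*2 | _ = a /ℕ 2 , trans a≡1+h*2 (reorder (a /ℕ 2))
    where
    reorder : ∀ h → + 1 + h * + 2 ≡ + 2 * h + 1ℤ
    reorder = solve-∀
  ... | suc (suc _) | _ | ℕ.s≤s (ℕ.s≤s ())

  pronic-cong : ∀ {M x y} → x ≡ y [mod M ] → pronic x ≡ pronic y [mod M ]
  pronic-cong x≡y = ≡[mod]-*-cong x≡y (≡[mod]-+-cong x≡y (≡[mod]-refl 1ℤ))

  square-cong : ∀ {M x y} → x ≡ y [mod M ] → square x ≡ square y [mod M ]
  square-cong x≡y = ≡[mod]-*-cong x≡y x≡y

  module _ (g : ℕ) (a₂ a₁ a₀ : ℤ) where

    private
      f : ℤ → ℤ
      f = quadPoly g a₂ a₁ a₀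

    quadPoly-difference : ∀ y c → 1ℤ * (f y - f c) ≡ + g * ((y - c) * (a₂ * (y + c) + a₁))
    quadPoly-difference y c = identity (+ g) a₂ a₁ a₀ y c
      where
      identity : ∀ G a₂ a₁ a₀ y c →
        1ℤ * ((G * (a₂ * y * y + a₁ * y) + a₀) - (G * (a₂ * c * c + a₁ * c) + a₀))
        ≡ G * ((y - c) * (a₂ * (y + c) + a₁))
      identity = solve-∀

    -- a₂ (a₂ x² + a₁ x) = W (W + 1) − h (h + 1)  for  W = a₂ x + h  and  a₁ = 2h + 1
    quadPoly-pronic : ∀ {h} → a₁ ≡ + 2 * h + 1ℤ → ∀ y c →
                      a₂ * (f y - f c) ≡ + g * ((pronic (a₂ * y + h) - pronic (a₂ * c + h)) * 1ℤ)
    quadPoly-pronic {h} refl y c = identity (+ g) a₂ h a₀ y c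
      where
      identity : ∀ G a₂ h a₀ y c →
        a₂ * ((G * (a₂ * y * y + (+ 2 * h + 1ℤ) * y) + a₀)
              - (G * (a₂ * c * c + (+ 2 * h + 1ℤ) * c) + a₀))
        ≡ G * (((a₂ * y + h) * ((a₂ * y + h) + 1ℤ) - (a₂ * c + h) * ((a₂ * c + h) + 1ℤ)) * 1ℤ)
      identity = solve-∀

    -- a₂ (a₂ x² + a₁ x) = W² − h²  for  W = a₂ x + h  and  a₁ = 2h
    quadPoly-square : ∀ {h} → a₁ ≡ + 2 * h → ∀ y c →
                      a₂ * (f y - f c) ≡ + g * ((square (a₂ * y + h) - square (a₂ * c + h)) * 1ℤ)
    quadPoly-square {h} refl y c = identity (+ g) a₂ h a₀ y c
      where
      identity : ∀ G a₂ h a₀ y c →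
        a₂ * ((G * (a₂ * y * y + (+ 2 * h) * y) + a₀) - (G * (a₂ * c * c + (+ 2 * h) * c) + a₀))
        ≡ G * (((a₂ * y + h) * (a₂ * y + h) - (a₂ * c + h) * (a₂ * c + h)) * 1ℤ)
      identity = solve-∀

    module _ {p : ℕ} (pr : Prime p) {a : ℕ → ℤ} (a-ordering : IsPOrdering p (image f) a) (l : ℕ)
             {α : ℕ} (g^l-val : HasValuation p (g ^ l) α) where
      private instance
        p≢0 : NonZero p
        p≢0 = prime⇒nonZero pr

      valuation-∣a₂ : p ∣ℕ ∣ a₂ ∣ → ¬ p ∣ℕ ∣ a₁ ∣ →
                      HasValuation p ∣ prodDiff a l (a l) ∣ (α ℕ.+ legendre p l)
      valuation-∣a₂ p∣a₂ p∤a₁ =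
        valuation-transport pr {κ = 1ℤ} quadPoly-difference (prime∤1 pr) p∤ε id
          (λ _ z → z , ≡[mod]-refl z) a-ordering (natural-pOrdering p) l g^l-val
          (subst (λ n → HasValuation p ∣ n ∣ (legendre p l)) (sym (falling-self l)) (valuation-! pr l))
        where
        p∤ε : ∀ y c → ¬ p ∣ℕ ∣ a₂ * (y + c) + a₁ ∣
        p∤ε y c p∣ε = p∤a₁ (ℤ.∣⇒∣ᵤ (ℤ.∣m+n∣m⇒∣n
          (ℤ.∣ᵤ⇒∣ {+ p} {a₂ * (y + c) + a₁} p∣ε) (ℤ.∣m⇒∣m*n (y + c) (ℤ.∣ᵤ⇒∣ {+ p} {a₂} p∣a₂))))

      module _ (p∤a₂ : ¬ p ∣ℕ ∣ a₂ ∣) where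

        private
          affine-onto-p^ : ∀ h e z → ∃ λ y → a₂ * y + h ≡ z [mod p ^ e ]
          affine-onto-p^ h e = affine-onto a₂ (coprime-^ (prime∤⇒coprime pr p∤a₂) e) h

        valuation-∤a₂-odd : ¬ 2 ∣ℕ ∣ a₁ ∣ →
                            HasValuation p ∣ prodDiff a l (a l) ∣ (α ℕ.+ legendre p (2 ℕ.* l))
        valuation-∤a₂-odd 2∤a₁ with ¬2∣⇒odd a₁ 2∤a₁
        ... | h , a₁≡2h+1 =
          valuation-transport pr {κ = a₂} (quadPoly-pronic a₁≡2h+1) p∤a₂ (λ _ _ → prime∤1 pr) pronic-cong
            (affine-onto-p^ h) a-ordering (pronic-pOrdering p) l g^l-val
            (subst (λ n → HasValuation p ∣ n ∣ (legendre p (2 ℕ.* l))) (sym (pronic-self l))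
              (valuation-! pr (2 ℕ.* l)))

        valuation-∤a₂-even : 2 ∣ℕ ∣ a₁ ∣ → ∀ {t} →
                             HasValuation p ∣ prodDiff (square ∘ +_) l (square (+ l)) ∣ t →
                             HasValuation p ∣ prodDiff a l (a l) ∣ (α ℕ.+ t)
        valuation-∤a₂-even 2∣a₁ square-val with 2∣⇒even a₁ 2∣a₁
        ... | h , a₁≡2h =
          valuation-transport pr {κ = a₂} (quadPoly-square a₁≡2h) p∤a₂ (λ _ _ → prime∤1 pr) square-cong
            (affine-onto-p^ h) a-ordering (square-pOrdering p) l g^l-val square-val


open import Data.Nat using (ℕ; _*_; _^_; _≥_)
open import Data.Integer using (ℤ; +_)
open import Data.Integer.GCD using (gcd)
open import Data.Product using (∃; _×_; _,_)
open import Relation.Binary.PropositionalEquality using (_≡_)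

module BhargavaFactorial (g : ℕ) (a₂ a₁ a₀ : ℤ) (g≥1 : g ≥ 1) (a₁⊥a₂ : gcd a₁ a₂ ≡ + 1)
                         (l : ℕ) (l≥1 : l ≥ 1) where

  open import Data.Nat as ℕ using (ℕ; _+_; _*_; _^_; _≤_; _≥_; _!; _≟_; NonZero; >-nonZero; >-nonZero⁻¹)
  open import Data.Nat.Properties
  open import Data.Nat.DivMod using (_/_; m*[n/m]≡n)
  open import Data.Nat.Divisibility using (_∣_; _∣?_; 1∣_; ∣n⇒∣m*n; m≤n⇒m!∣n!)
  open import Data.Nat.Primality using (Prime; prime[2]; prime⇒nonZero)
  open import Data.Integer using (ℤ; +_; ∣_∣)
  open import Data.Integer.GCD using (gcd; gcd-greatest)
  open import Data.Bool using (true; false)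
  open import Data.Product using (∃; _×_; _,_)
  open import Data.Sum using (_⊎_; inj₁; inj₂)
  open import Function using (_∘_)
  open import Relation.Nullary using (¬_; Dec; yes; no; does)
  open import Relation.Nullary.Decidable using (dec-true; dec-false)
  open import Relation.Binary.PropositionalEquality
  open import Algebra.Properties.CommutativeSemigroup +-commutativeSemigroup using (x∙yz≈y∙xz)
  open Valuation
  open Legendre using (valuation-!)
  open PrimeProduct
  open DivisibilityOrderings using (square; 2*∣square-self∣)
  open QuadraticImage

  δ : ℕ
  δ = delta a₁ a₂

  δ-odd : ¬ 2 ∣ ∣ a₁ ∣ → δ ≡ 0
  δ-odd 2∤a₁ rewrite dec-false (2 ∣? ∣ a₁ ∣) 2∤a₁ = refl

  δ-∣a₂ : 2 ∣ ∣ a₂ ∣ → δ ≡ 0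
  δ-∣a₂ 2∣a₂ rewrite dec-true (2 ∣? ∣ a₂ ∣) 2∣a₂ with does (2 ∣? ∣ a₁ ∣)
  ... | true  = refl
  ... | false = refl

  δ-even-odd : 2 ∣ ∣ a₁ ∣ → ¬ 2 ∣ ∣ a₂ ∣ → δ ≡ 1
  δ-even-odd 2∣a₁ 2∤a₂
    rewrite dec-true (2 ∣? ∣ a₁ ∣) 2∣a₁ | dec-false (2 ∣? ∣ a₂ ∣) 2∤a₂ = refl

  ∣a₂⇒∤a₁ : ∀ {p} → Prime p → p ∣ ∣ a₂ ∣ → ¬ p ∣ ∣ a₁ ∣
  ∣a₂⇒∤a₁ {p} pr p∣a₂ p∣a₁ =
    prime∤1 pr (subst (λ z → p ∣ ∣ z ∣) a₁⊥a₂ (gcd-greatest {a₁} {a₂} {+ p} p∣a₁ p∣a₂))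

  N : ℕ
  N = g ^ l * primeProduct a₂ l

  2^δ∣N : 2 ^ δ ∣ N
  2^δ∣N with 2 ∣? ∣ a₁ ∣ | 2 ∣? ∣ a₂ ∣
  ... | no 2∤a₁ | _        = subst (λ k → 2 ^ k ∣ N) (sym (δ-odd 2∤a₁)) (1∣ N)
  ... | yes _   | yes 2∣a₂ = subst (λ k → 2 ^ k ∣ N) (sym (δ-∣a₂ 2∣a₂)) (1∣ N)
  ... | yes 2∣a₁ | no 2∤a₂ =
    subst (λ k → 2 ^ k ∣ N) (sym (δ-even-odd 2∣a₁ 2∤a₂)) (∣n⇒∣m*n (g ^ l) 2∣PP)
    where
    2∣[2l]! : 2 ^ 1 ∣ (2 * l) !
    2∣[2l]! = m≤n⇒m!∣n! (*-monoʳ-≤ 2 l≥1)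
    2∣PP : 2 ^ 1 ∣ primeProduct a₂ l
    2∣PP = valuation-≤⇒∣ prime[2] (valuation-primeProduct a₂ l prime[2])
             (subst (1 ≤_) (sym (primeExponent-∤ a₂ l prime[2] 2∤a₂))
               (valuation-∣⇒≤ prime[2] (valuation-! prime[2] (2 * l)) 2∣[2l]!))

  squareFactorial : ℕ
  squareFactorial = ∣ prodDiff (square ∘ +_) l (square (+ l)) ∣

  squareFactorial>0 : 0 ℕ.< squareFactorial
  squareFactorial>0 =
    >-nonZero⁻¹ _ {{m*n≢0⇒n≢0 2 {{subst NonZero (sym (2*∣square-self∣ l≥1)) ((2 * l) !≢0)}}}}

  N>0 : 0 ℕ.< N
  N>0 = *-mono-≤ (m^n>0 g {{>-nonZero g≥1}} l) (valuation⇒>0 prime[2] (valuation-primeProduct a₂ l prime[2]))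

  L : ℕ
  L = (N / 2 ^ δ) {{m^n≢0 2 δ}}

  2^δ*L≡N : 2 ^ δ * L ≡ N
  2^δ*L≡N = m*[n/m]≡n {{m^n≢0 2 δ}} 2^δ∣N

  L≢0 : NonZero L
  L≢0 = m*n≢0⇒n≢0 (2 ^ δ) {{subst NonZero (sym 2^δ*L≡N) (>-nonZero N>0)}}

  module _ {p : ℕ} (pr : Prime p) {a : ℕ → ℤ}
           (a-ordering : IsPOrdering p (image (quadPoly g a₂ a₁ a₀)) a)
           {α d : ℕ} (g^l-val : HasValuation p (g ^ l) α) (2^δ-val : HasValuation p (2 ^ δ) d) where
    private instance
      p≢0 : NonZero p
      p≢0 = prime⇒nonZero pr

    d≡0 : p ≢ 2 ⊎ δ ≡ 0 → d ≡ 0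
    d≡0 (inj₁ p≢2) = valuation-unique pr 2^δ-val (valuation-2^-≢ pr p≢2 δ)
    d≡0 (inj₂ δ≡0) = valuation-unique pr 2^δ-val
                       (subst (λ k → HasValuation p (2 ^ k) 0) (sym δ≡0) (valuation-∤ pr (prime∤1 pr)))

    ExponentSplit : Set
    ExponentSplit = ∃ λ t → HasValuation p ∣ prodDiff a l (a l) ∣ (α + t) × primeExponent a₂ l p ≡ d + t

    split-∣a₂ : p ∣ ∣ a₂ ∣ → ExponentSplit
    split-∣a₂ p∣a₂ =
      legendre p l ,
      valuation-∣a₂ g a₂ a₁ a₀ pr a-ordering l g^l-val p∣a₂ (∣a₂⇒∤a₁ pr p∣a₂) ,
      trans (primeExponent-∣ a₂ l pr p∣a₂) (cong (_+ legendre p l) (sym (d≡0 p≢2⊎δ≡0)))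
      where
      p≢2⊎δ≡0 : p ≢ 2 ⊎ δ ≡ 0
      p≢2⊎δ≡0 with p ≟ 2
      ... | yes refl = inj₂ (δ-∣a₂ p∣a₂)
      ... | no  p≢2  = inj₁ p≢2

    split-odd : ¬ p ∣ ∣ a₂ ∣ → ¬ 2 ∣ ∣ a₁ ∣ → ExponentSplit
    split-odd p∤a₂ 2∤a₁ =
      legendre p (2 * l) , valuation-∤a₂-odd g a₂ a₁ a₀ pr a-ordering l g^l-val p∤a₂ 2∤a₁ ,
      trans (primeExponent-∤ a₂ l pr p∤a₂)
            (cong (_+ legendre p (2 * l)) (sym (d≡0 (inj₂ (δ-odd 2∤a₁)))))

    -- (2l)! = 2 · squareFactorial, and v_p(2) = v_p(2^δ) here: δ = 1 unless 2 ∣ a₂, and then p ≠ 2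
    split-even : ¬ p ∣ ∣ a₂ ∣ → 2 ∣ ∣ a₁ ∣ → ExponentSplit
    split-even p∤a₂ 2∣a₁ with valuation-exists pr squareFactorial squareFactorial>0
    ... | t , X-val =
      t , valuation-∤a₂-even g a₂ a₁ a₀ pr a-ordering l g^l-val p∤a₂ 2∣a₁ X-val ,
      trans (primeExponent-∤ a₂ l pr p∤a₂)
        (valuation-unique pr (valuation-! pr (2 * l))
          (subst (λ n → HasValuation p n (d + t)) (2*∣square-self∣ l≥1) (valuation-* pr 2-val X-val)))
      where
      2-val : HasValuation p 2 d
      2-val with 2 ∣? ∣ a₂ ∣
      ... | yes 2∣a₂ = subst (HasValuation p 2) (sym (d≡0 (inj₂ (δ-∣a₂ 2∣a₂))))
                         (valuation-2^-≢ pr (λ { refl → p∤a₂ 2∣a₂ }) 1)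
      ... | no  2∤a₂ = subst (λ k → HasValuation p (2 ^ k) d) (δ-even-odd 2∣a₁ 2∤a₂) 2^δ-val

    exponent-split : ExponentSplit
    exponent-split = by-cases (p ∣? ∣ a₂ ∣) (2 ∣? ∣ a₁ ∣)
      where
      by-cases : Dec (p ∣ ∣ a₂ ∣) → Dec (2 ∣ ∣ a₁ ∣) → ExponentSplit
      by-cases (yes p∣a₂) _          = split-∣a₂ p∣a₂
      by-cases (no  p∤a₂) (no  2∤a₁) = split-odd p∤a₂ 2∤a₁
      by-cases (no  p∤a₂) (yes 2∣a₁) = split-even p∤a₂ 2∣a₁

    valuation-L : ∀ {t} → primeExponent a₂ l p ≡ d + t → HasValuation p L (α + t)
    valuation-L {t} E≡d+t = valuation-*-cancelˡ pr 2^δ-val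
      (subst₂ (HasValuation p) (sym 2^δ*L≡N) (trans (cong (λ E → α + E) E≡d+t) (x∙yz≈y∙xz α d t))
        (valuation-* pr g^l-val (valuation-primeProduct a₂ l pr)))

  same-valuation : ∀ {p} → Prime p → ∀ {a} → IsPOrdering p (image (quadPoly g a₂ a₁ a₀)) a →
                   ∃ λ T → HasValuation p L T × HasValuation p ∣ prodDiff a l (a l) ∣ T
  same-valuation pr a-ordering
    with valuation-exists pr (g ^ l) (m^n>0 g {{>-nonZero g≥1}} l) | valuation-exists pr (2 ^ δ) (m^n>0 2 δ)
  ... | α , g^l-val | d , 2^δ-val with exponent-split pr a-ordering g^l-val 2^δ-val
  ... | t , P-val , E≡d+t = α + t , valuation-L pr a-ordering g^l-val 2^δ-val E≡d+t , P-val


theorem4p3 : (g : ℕ) (a₂ a₁ a₀ : ℤ) → g ≥ 1 → gcd a₁ a₂ ≡ + 1 →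
    (l : ℕ) → l ≥ 1 →
    ∃ λ (L : ℕ) → IsBhargavaFactorial (image (quadPoly g a₂ a₁ a₀)) l L
    × 2 ^ delta a₁ a₂ * L ≡ g ^ l * primeProduct a₂ l
theorem4p3 g a₂ a₁ a₀ g≥1 a₁⊥a₂ l l≥1 =
  L , (L≢0 , λ p pr a a-ordering → let _ , L-val , P-val = same-valuation pr a-ordering
                                   in Valuation.valuation-⇔ pr L-val P-val) , 2^δ*L≡N
  where open BhargavaFactorial g a₂ a₁ a₀ g≥1 a₁⊥a₂ l l≥1
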